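{- Let $E: y^2=x^3+ax^2+bx+c$ ($a,b,c\in\mathbb{Z}$) be an elliptic curve and $P\in E(\mathbb{Q})$ a point of infinite order. If $2\mid e_t$ for some $t\ge0$, then for all $k\ge t$, either $F_k(E,P)=2$ or $F_k(E,P)$ is composite.
   Context: An elliptic curve is a non-singular cubic $y^2=x^3+ax^2+bx+c$ with $a,b,c\in\mathbb{Z}$. For $k\ge0$ write $2^kP=\left(\frac{m_k}{e_k^2},\frac{n_k}{e_k^3}\right)$ with $m_k,n_k,e_k\in\mathbb{Z}$, $e_k\ge1$, $\gcd(m_k,e_k)=\gcd(n_k,e_k)=1$. Define $F_0(E,P)=e_0$ and $F_k(E,P)=e_k/e_{k-1}$ for $k\ge1$. -}

module Defs where

open import Data.Nat as ℕ using (ℕ; zero; suc)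
open import Data.Nat.Coprimality using (Coprime)
open import Data.Integer as ℤ using (ℤ; +_)
open import Data.Rational as ℚ using (ℚ; 0ℚ; _+_; _*_; _-_; -_; 1/_; _/_)
open import Data.Rational.Properties using (_≟_)
open import Data.Maybe using (Maybe; just; nothing)
open import Data.Product using (_×_; _,_; ∃-syntax)
open import Relation.Nullary using (yes; no; ¬_)
open import Relation.Binary.PropositionalEquality using (_≡_; _≢_)
open import Function using (_∘_)

disc : ℤ → ℤ → ℤ → ℤ
disc a b c = (a ℤ.* a ℤ.* b ℤ.* b) ℤ.- (+ 4 ℤ.* b ℤ.* b ℤ.* b)
             ℤ.- (+ 4 ℤ.* a ℤ.* a ℤ.* a ℤ.* c) ℤ.- (+ 27 ℤ.* c ℤ.* c)
             ℤ.+ (+ 18 ℤ.* a ℤ.* b ℤ.* c)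

IsElliptic : ℤ → ℤ → ℤ → Set
IsElliptic a b c = disc a b c ≢ + 0

ι : ℤ → ℚ
ι z = z / 1

OnCurve : ℤ → ℤ → ℤ → ℚ → ℚ → Set
OnCurve a b c x y = y * y ≡ x * x * x + ι a * x * x + ι b * x + ι c

-- Rational points of E: nothing = point at infinity O.
Pt : Set
Pt = Maybe (ℚ × ℚ)

-- total inverse (only ever used on non-zero arguments)
inv : ℚ → ℚ
inv q with q ≟ 0ℚ
... | yes _ = 0ℚ
... | no q≢0 = 1/_ q {{ℚ.≢-nonZero q≢0}}

add : ℤ → ℤ → ℤ → Pt → Pt → Pt
add a b c nothing Q = Q
add a b c (just P) nothing = just P
add a b c (just (x₁ , y₁)) (just (x₂ , y₂)) with x₁ ≟ x₂
... | no _ = third ((y₂ - y₁) * inv (x₂ - x₁))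
  where
  third : ℚ → Pt
  third λ' = let x₃ = λ' * λ' - ι a - x₁ - x₂
             in just (x₃ , - (y₁ + λ' * (x₃ - x₁)))
... | yes _ with y₁ + y₂ ≟ 0ℚ
...   | yes _ = nothing
...   | no _ = third ((ι (+ 3) * x₁ * x₁ + ι (+ 2) * ι a * x₁ + ι b) * inv (ι (+ 2) * y₁))
  where
  third : ℚ → Pt
  third λ' = let x₃ = λ' * λ' - ι a - x₁ - x₂
             in just (x₃ , - (y₁ + λ' * (x₃ - x₁)))

mul : ℤ → ℤ → ℤ → ℕ → Pt → Pt
mul a b c zero P = nothing
mul a b c (suc n) P = add a b c P (mul a b c n P)

InfiniteOrder : ℤ → ℤ → ℤ → Pt → Set
InfiniteOrder a b c P = ∀ n → mul a b c (suc n) P ≢ nothing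

dbl^ : ℤ → ℤ → ℤ → ℕ → Pt → Pt
dbl^ a b c zero P = P
dbl^ a b c (suc k) P = let Q = dbl^ a b c k P in add a b c Q Q

-- IsE a b c P k e :  2^k P = (m/e^2 , n/e^3) with m n ∈ ℤ, e ≥ 1,
-- gcd(m,e) = gcd(n,e) = 1.  (i.e. e = e_k)
IsE : ℤ → ℤ → ℤ → Pt → ℕ → ℕ → Set
IsE a b c P k e = 1 ℕ.≤ e × ∃[ x ] ∃[ y ] ∃[ m ] ∃[ n ]
  ( dbl^ a b c k P ≡ just (x , y)
  × x ≡ m / 1 * inv (ι (+ (e ℕ.^ 2)))
  × y ≡ n / 1 * inv (ι (+ (e ℕ.^ 3)))
  × Coprime (ℤ.∣ m ∣) e × Coprime (ℤ.∣ n ∣) e )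

-- IsF a b c P k f :  F_k(E,P) = f, where F_0 = e_0 and F_k = e_k / e_{k-1}
-- (read as: e_k = f · e_{k-1}).
IsF : ℤ → ℤ → ℤ → Pt → ℕ → ℕ → Set
IsF a b c P zero f = IsE a b c P zero f
IsF a b c P (suc k) f = ∃[ e ] ∃[ e' ]
  (IsE a b c P (suc k) e × IsE a b c P k e' × e ≡ f ℕ.* e')

-- Write 2^k P = (m/e², n/e³) in lowest terms. The tangent construction gives
-- x(2^(k+1) P) = X/(2ne)² with X = m⁴ + e²·w for an integer w, so X is coprime
-- to e, and even to 2e when e is even (then m is odd). Clearing denominators in
-- x(2^(k+1) P) = m′/e′² therefore gives e ∣ e′, and 2e ∣ e′ when e is even.
-- An even e also forces y ≠ 0, so the doubling never reaches O: once e_t is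
-- even, every later e_k is even and F_k = e_k/e_(k-1) is even (by 2e ∣ e′ if
-- e_(k-1) is even, by Euclid's lemma otherwise), hence 2 or composite.
module Submission where

open import Defs
open import Level using (0ℓ)
open import Data.Nat as ℕ using (ℕ; zero; suc; NonZero; _≤_; _≤′_; ≤′-refl; ≤′-step)
import Data.Nat.Properties as ℕP
open import Data.Nat.Divisibility
open import Data.Nat.Coprimality as Coprimality using (Coprime; coprime-divisor)
open import Data.Nat.GCD using (gcd; gcd[m,n]∣m; gcd[m,n]∣n; gcd[m,n]≡0⇒m≡0; gcd[m,n]≡0⇒n≡0)
open import Data.Nat.DivMod using (_/_; m/n*n≡m)
open import Data.Nat.Primality using (Composite; composite-≢; euclidsLemma; prime[2])
import Data.Nat.Tactic.RingSolver as ℕ-Solver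
open import Data.Integer as ℤ using (ℤ; +_; ∣_∣)
import Data.Integer.Properties as ℤP
import Data.Integer.Divisibility.Signed as ℤ∣
import Data.Integer.Tactic.RingSolver as ℤ-Solver
open import Data.Rational as ℚ using (ℚ; 0ℚ; 1ℚ; ½; toℚᵘ)
import Data.Rational.Properties as ℚP
import Data.Rational.Unnormalised as ℚᵘ
import Data.Rational.Unnormalised.Properties as ℚᵘP
open import Data.Maybe using (just; nothing)
open import Data.Product using (_×_; _,_; ∃-syntax; proj₁; proj₂)
open import Data.Sum using (_⊎_; inj₁; inj₂)
open import Data.List using ([]; _∷_)
open import Function using (case_of_; it)
open import Relation.Nullary using (yes; no; contradiction)
open import Relation.Nullary.Decidable using (dec⇒maybe)
open import Relation.Binary.PropositionalEquality
open import Tactic.RingSolver using (solve)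
import Tactic.RingSolver.Core.AlmostCommutativeRing as ACR

module _ where

  open import Data.Rational using (_+_; _*_; _-_; -_)

  ℚ-ring : ACR.AlmostCommutativeRing 0ℓ 0ℓ
  ℚ-ring = ACR.fromCommutativeRing ℚP.+-*-commutativeRing (λ q → dec⇒maybe (0ℚ ℚP.≟ q))

  ιᵘ : ℤ → ℚᵘ.ℚᵘ
  ιᵘ z = ℚᵘ.mkℚᵘ z 0

  toℚᵘ-ι : ∀ z → toℚᵘ (ι z) ℚᵘ.≃ ιᵘ z
  toℚᵘ-ι z = ℚP.toℚᵘ-fromℚᵘ (ιᵘ z)

  ι-injective : ∀ {p q} → ι p ≡ ι q → p ≡ q
  ι-injective {p} {q} ιp≡ιq with ℚP.fromℚᵘ-injective {ιᵘ p} {ιᵘ q} ιp≡ιq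
  ... | ℚᵘ.*≡* p*1≡q*1 = begin
    p         ≡⟨ ℤP.*-identityʳ p ⟨
    p ℤ.* + 1 ≡⟨ p*1≡q*1 ⟩
    q ℤ.* + 1 ≡⟨ ℤP.*-identityʳ q ⟩
    q         ∎
    where open ≡-Reasoning

  ι-+ : ∀ p q → ι (p ℤ.+ q) ≡ ι p + ι q
  ι-+ p q = ℚP.toℚᵘ-injective (begin
    toℚᵘ (ι (p ℤ.+ q))         ≈⟨ toℚᵘ-ι (p ℤ.+ q) ⟩
    ιᵘ (p ℤ.+ q)               ≈⟨ ℚᵘ.*≡* (sum-over-1 p q) ⟩
    ιᵘ p ℚᵘ.+ ιᵘ q             ≈⟨ ℚᵘP.+-cong (toℚᵘ-ι p) (toℚᵘ-ι q) ⟨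
    toℚᵘ (ι p) ℚᵘ.+ toℚᵘ (ι q) ≈⟨ ℚP.toℚᵘ-homo-+ (ι p) (ι q) ⟨
    toℚᵘ (ι p + ι q)           ∎)
    where
    open ℚᵘP.≃-Reasoning
    sum-over-1 : ∀ p q → (p ℤ.+ q) ℤ.* + 1 ≡ (p ℤ.* + 1 ℤ.+ q ℤ.* + 1) ℤ.* + 1
    sum-over-1 = ℤ-Solver.solve-∀

  ι-* : ∀ p q → ι (p ℤ.* q) ≡ ι p * ι q
  ι-* p q = ℚP.toℚᵘ-injective (begin
    toℚᵘ (ι (p ℤ.* q))         ≈⟨ toℚᵘ-ι (p ℤ.* q) ⟩
    ιᵘ (p ℤ.* q)               ≈⟨ ℚᵘ.*≡* refl ⟩
    ιᵘ p ℚᵘ.* ιᵘ q             ≈⟨ ℚᵘP.*-cong (toℚᵘ-ι p) (toℚᵘ-ι q) ⟨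
    toℚᵘ (ι p) ℚᵘ.* toℚᵘ (ι q) ≈⟨ ℚP.toℚᵘ-homo-* (ι p) (ι q) ⟨
    toℚᵘ (ι p * ι q)           ∎)
    where open ℚᵘP.≃-Reasoning

  ι-neg : ∀ p → ι (ℤ.- p) ≡ - ι p
  ι-neg p = ℚP.toℚᵘ-injective (begin
    toℚᵘ (ι (ℤ.- p)) ≈⟨ toℚᵘ-ι (ℤ.- p) ⟩
    ιᵘ (ℤ.- p)       ≈⟨ ℚᵘP.-‿cong (toℚᵘ-ι p) ⟨
    ℚᵘ.- toℚᵘ (ι p)  ≈⟨ ℚP.toℚᵘ-homo‿- (ι p) ⟨
    toℚᵘ (- ι p)     ∎)
    where open ℚᵘP.≃-Reasoning

  ι-pos-* : ∀ p q → ι (+ (p ℕ.* q)) ≡ ι (+ p) * ι (+ q)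
  ι-pos-* p q = trans (cong ι (ℤP.pos-* p q)) (ι-* (+ p) (+ q))

  ι-square : ∀ e → ι (+ (e ℕ.^ 2)) ≡ ι (+ e) * ι (+ e)
  ι-square e = trans (ι-pos-* e (e ℕ.* 1)) (cong (λ k → ι (+ e) * ι (+ k)) (ℕP.*-identityʳ e))

  ι-cube : ∀ e → ι (+ (e ℕ.^ 3)) ≡ ι (+ e) * ι (+ e) * ι (+ e)
  ι-cube e = trans (ι-pos-* e (e ℕ.^ 2))
    (trans (cong (ι (+ e) *_) (ι-square e)) (sym (ℚP.*-assoc (ι (+ e)) (ι (+ e)) (ι (+ e)))))

  ι-pos≢0 : ∀ n → .{{NonZero n}} → ι (+ n) ≢ 0ℚ
  ι-pos≢0 (suc n) ι[1+n]≡0 with ι-injective {+ suc n} {+ 0} ι[1+n]≡0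
  ... | ()

  *-↧≡↥ : ∀ q → q * ι (+ ℚ.↧ₙ q) ≡ ι (ℚ.↥ q)
  *-↧≡↥ q@(ℚ.mkℚ n d-1 _) = ℚP.toℚᵘ-injective (begin
    toℚᵘ (q * ι (+ d))          ≈⟨ ℚP.toℚᵘ-homo-* q (ι (+ d)) ⟩
    toℚᵘ q ℚᵘ.* toℚᵘ (ι (+ d))  ≈⟨ ℚᵘP.*-congˡ {toℚᵘ q} (toℚᵘ-ι (+ d)) ⟩
    ℚᵘ.mkℚᵘ n d-1 ℚᵘ.* ιᵘ (+ d) ≈⟨ ℚᵘ.*≡* cancel-d ⟩
    ιᵘ n                        ≈⟨ toℚᵘ-ι n ⟨
    toℚᵘ (ι n)                  ∎)
    where
    open ℚᵘP.≃-Reasoning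
    d = suc d-1
    cancel-d : n ℤ.* + d ℤ.* + 1 ≡ n ℤ.* + (d ℕ.* 1)
    cancel-d = trans (ℤP.*-identityʳ (n ℤ.* + d)) (cong (λ k → n ℤ.* + k) (sym (ℕP.*-identityʳ d)))

  -- An identity between the rational values of two integer expressions, proved
  -- by the solver over ℚ, is read back as an identity in ℤ.
  infixl 6 _⊕_
  infixl 7 _⊗_
  infix 8 ⊝_

  data IntExpr : Set where
    lit     : ℤ → IntExpr
    _⊕_ _⊗_ : IntExpr → IntExpr → IntExpr
    ⊝_      : IntExpr → IntExpr

  ⟦_⟧ℤ : IntExpr → ℤ
  ⟦ lit z ⟧ℤ = z
  ⟦ p ⊕ q ⟧ℤ = ⟦ p ⟧ℤ ℤ.+ ⟦ q ⟧ℤ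
  ⟦ p ⊗ q ⟧ℤ = ⟦ p ⟧ℤ ℤ.* ⟦ q ⟧ℤ
  ⟦ ⊝ p ⟧ℤ   = ℤ.- ⟦ p ⟧ℤ

  ⟦_⟧ℚ : IntExpr → ℚ
  ⟦ lit z ⟧ℚ = ι z
  ⟦ p ⊕ q ⟧ℚ = ⟦ p ⟧ℚ + ⟦ q ⟧ℚ
  ⟦ p ⊗ q ⟧ℚ = ⟦ p ⟧ℚ * ⟦ q ⟧ℚ
  ⟦ ⊝ p ⟧ℚ   = - ⟦ p ⟧ℚ

  ι-⟦⟧ : ∀ p → ι ⟦ p ⟧ℤ ≡ ⟦ p ⟧ℚ
  ι-⟦⟧ (lit z) = refl
  ι-⟦⟧ (p ⊕ q) = trans (ι-+ ⟦ p ⟧ℤ ⟦ q ⟧ℤ) (cong₂ _+_ (ι-⟦⟧ p) (ι-⟦⟧ q))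
  ι-⟦⟧ (p ⊗ q) = trans (ι-* ⟦ p ⟧ℤ ⟦ q ⟧ℤ) (cong₂ _*_ (ι-⟦⟧ p) (ι-⟦⟧ q))
  ι-⟦⟧ (⊝ p)   = trans (ι-neg ⟦ p ⟧ℤ) (cong -_ (ι-⟦⟧ p))

  ⟦⟧ℚ-injective : ∀ p q → ⟦ p ⟧ℚ ≡ ⟦ q ⟧ℚ → ⟦ p ⟧ℤ ≡ ⟦ q ⟧ℤ
  ⟦⟧ℚ-injective p q eq = ι-injective (trans (ι-⟦⟧ p) (trans eq (sym (ι-⟦⟧ q))))

  *-inv : ∀ {q} → q ≢ 0ℚ → q * inv q ≡ 1ℚ
  *-inv {q} q≢0 with q ℚP.≟ 0ℚ
  ... | yes q≡0 = contradiction q≡0 q≢0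
  ... | no q≢0′ = ℚP.*-inverseʳ q {{ℚ.≢-nonZero q≢0′}}

  *-inv-cancelʳ : ∀ {q} → q ≢ 0ℚ → ∀ p → p * q * inv q ≡ p
  *-inv-cancelʳ {q} q≢0 p = begin
    p * q * inv q   ≡⟨ ℚP.*-assoc p q (inv q) ⟩
    p * (q * inv q) ≡⟨ cong (p *_) (*-inv q≢0) ⟩
    p * 1ℚ          ≡⟨ ℚP.*-identityʳ p ⟩
    p               ∎
    where open ≡-Reasoning

  inv-*-cancelʳ : ∀ {q} → q ≢ 0ℚ → ∀ p → p * inv q * q ≡ p
  inv-*-cancelʳ {q} q≢0 p = begin
    p * inv q * q   ≡⟨ ℚP.*-assoc p (inv q) q ⟩
    p * (inv q * q) ≡⟨ cong (p *_) (trans (ℚP.*-comm (inv q) q) (*-inv q≢0)) ⟩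
    p * 1ℚ          ≡⟨ ℚP.*-identityʳ p ⟩
    p               ∎
    where open ≡-Reasoning

  ≡*inv⇒*≡ : ∀ {p q r} → q ≢ 0ℚ → p ≡ r * inv q → p * q ≡ r
  ≡*inv⇒*≡ {r = r} q≢0 refl = inv-*-cancelʳ q≢0 r

  *≡⇒≡*inv : ∀ {p q r} → q ≢ 0ℚ → p * q ≡ r → p ≡ r * inv q
  *≡⇒≡*inv {p} q≢0 refl = sym (*-inv-cancelʳ q≢0 p)

  -- The hypothesis x + x + x′ ≡ L * L - A says that x, x and x′ are the three
  -- roots of the cubic cut out by the tangent line of slope L.
  tangent-onCurve : ∀ A B C x y L x′ →
    y * y ≡ x * x * x + A * x * x + B * x + C →
    L * (ι (+ 2) * y) ≡ ι (+ 3) * x * x + ι (+ 2) * A * x + B →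
    x + x + x′ ≡ L * L - A →
    (- (y + L * (x′ - x))) * (- (y + L * (x′ - x))) ≡ x′ * x′ * x′ + A * x′ * x′ + B * x′ + C
  tangent-onCurve A B C x y L x′ curve tangent roots = begin
    (- (y + L * (x′ - x))) * (- (y + L * (x′ - x)))
      ≡⟨ solve (A ∷ x ∷ y ∷ L ∷ x′ ∷ []) ℚ-ring ⟩
    y * y + L * (ι (+ 2) * y) * (x′ - x) + (L * L - A + A) * ((x′ - x) * (x′ - x))
      ≡⟨ cong₂ (λ u v → u + v * (x′ - x) + (L * L - A + A) * ((x′ - x) * (x′ - x))) curve tangent ⟩
    x * x * x + A * x * x + B * x + C + (ι (+ 3) * x * x + ι (+ 2) * A * x + B) * (x′ - x)
      + (L * L - A + A) * ((x′ - x) * (x′ - x))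
      ≡⟨ cong (λ u → x * x * x + A * x * x + B * x + C + (ι (+ 3) * x * x + ι (+ 2) * A * x + B) * (x′ - x)
                    + (u + A) * ((x′ - x) * (x′ - x))) (sym roots) ⟩
    x * x * x + A * x * x + B * x + C + (ι (+ 3) * x * x + ι (+ 2) * A * x + B) * (x′ - x)
      + (x + x + x′ + A) * ((x′ - x) * (x′ - x))
      ≡⟨ solve (A ∷ B ∷ C ∷ x ∷ x′ ∷ []) ℚ-ring ⟩
    x′ * x′ * x′ + A * x′ * x′ + B * x′ + C ∎
    where open ≡-Reasoning

  tangent-x : ∀ A B C x y L x′ →
    y * y ≡ x * x * x + A * x * x + B * x + C →
    L * (ι (+ 2) * y) ≡ ι (+ 3) * x * x + ι (+ 2) * A * x + B →
    x + x + x′ ≡ L * L - A →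
    x′ * (ι (+ 4) * (y * y)) ≡
      (ι (+ 3) * x * x + ι (+ 2) * A * x + B) * (ι (+ 3) * x * x + ι (+ 2) * A * x + B)
      - ι (+ 4) * (A + x + x) * (x * x * x + A * x * x + B * x + C)
  tangent-x A B C x y L x′ curve tangent roots = begin
    x′ * (ι (+ 4) * (y * y))
      ≡⟨ solve (x ∷ x′ ∷ y ∷ []) ℚ-ring ⟩
    (x + x + x′) * (ι (+ 4) * (y * y)) - (x + x) * (ι (+ 4) * (y * y))
      ≡⟨ cong (λ u → u * (ι (+ 4) * (y * y)) - (x + x) * (ι (+ 4) * (y * y))) roots ⟩
    (L * L - A) * (ι (+ 4) * (y * y)) - (x + x) * (ι (+ 4) * (y * y))
      ≡⟨ solve (A ∷ x ∷ y ∷ L ∷ []) ℚ-ring ⟩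
    L * (ι (+ 2) * y) * (L * (ι (+ 2) * y)) - ι (+ 4) * (A + x + x) * (y * y)
      ≡⟨ cong₂ (λ u v → u * u - ι (+ 4) * (A + x + x) * v) tangent curve ⟩
    _ ∎
    where open ≡-Reasoning

  doubling-numerator : ∀ A B C x y L x′ E E′ →
    y * y ≡ x * x * x + A * x * x + B * x + C →
    L * (ι (+ 2) * y) ≡ ι (+ 3) * x * x + ι (+ 2) * A * x + B →
    x + x + x′ ≡ L * L - A →
    ∀ {M N M′} → x * (E * E) ≡ M → y * (E * E * E) ≡ N → x′ * (E′ * E′) ≡ M′ →
    M′ * ((ι (+ 2) * N * E) * (ι (+ 2) * N * E)) ≡
      (M * M * M * M + E * E * ((B * B - ι (+ 4) * A * C) * (E * E * E * E * E * E)
        - ι (+ 2) * B * M * M * (E * E) - ι (+ 8) * C * M * (E * E * E * E))) * (E′ * E′)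
  doubling-numerator A B C x y L x′ E E′ curve tangent roots refl refl refl = begin
    x′ * (E′ * E′) * ((ι (+ 2) * (y * (E * E * E)) * E) * (ι (+ 2) * (y * (E * E * E)) * E))
      ≡⟨ solve (x′ ∷ y ∷ E ∷ E′ ∷ []) ℚ-ring ⟩
    x′ * (ι (+ 4) * (y * y)) * (E * E * E * E * E * E * E * E * (E′ * E′))
      ≡⟨ cong (_* (E * E * E * E * E * E * E * E * (E′ * E′))) (tangent-x A B C x y L x′ curve tangent roots) ⟩
    ((ι (+ 3) * x * x + ι (+ 2) * A * x + B) * (ι (+ 3) * x * x + ι (+ 2) * A * x + B)
      - ι (+ 4) * (A + x + x) * (x * x * x + A * x * x + B * x + C)) * (E * E * E * E * E * E * E * E * (E′ * E′))
      ≡⟨ solve (A ∷ B ∷ C ∷ x ∷ E ∷ E′ ∷ []) ℚ-ring ⟩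
    _ ∎
    where open ≡-Reasoning

  homogenised-curve : ∀ A B C x y D D′ U V →
    y * y ≡ x * x * x + A * x * x + B * x + C → x * D ≡ U → y * D′ ≡ V →
    V * V * (D * D * D) ≡ D′ * D′ * (U * U * U + D * (A * U * U + B * U * D + C * (D * D)))
  homogenised-curve A B C x y D D′ U V curve refl refl = begin
    y * D′ * (y * D′) * (D * D * D)
      ≡⟨ solve (y ∷ D ∷ D′ ∷ []) ℚ-ring ⟩
    y * y * (D′ * D′ * (D * D * D))
      ≡⟨ cong (_* (D′ * D′ * (D * D * D))) curve ⟩
    (x * x * x + A * x * x + B * x + C) * (D′ * D′ * (D * D * D))
      ≡⟨ solve (A ∷ B ∷ C ∷ x ∷ D ∷ D′ ∷ []) ℚ-ring ⟩
    D′ * D′ * (x * D * (x * D) * (x * D) + D * (A * (x * D) * (x * D) + B * (x * D) * D + C * (D * D))) ∎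
    where open ≡-Reasoning

  tangentSlope : ℤ → ℤ → ℚ → ℚ → ℚ
  tangentSlope a b x y = (ι (+ 3) * x * x + ι (+ 2) * ι a * x + ι b) * inv (ι (+ 2) * y)

  doubleX : ℤ → ℤ → ℚ → ℚ → ℚ
  doubleX a b x y = tangentSlope a b x y * tangentSlope a b x y - ι a - x - x

  doubleY : ℤ → ℤ → ℚ → ℚ → ℚ
  doubleY a b x y = - (y + tangentSlope a b x y * (doubleX a b x y - x))

  add-self : ∀ a b c x y → y + y ≢ 0ℚ →
    add a b c (just (x , y)) (just (x , y)) ≡ just (doubleX a b x y , doubleY a b x y)
  add-self a b c x y y+y≢0 with x ℚP.≟ x
  ... | no x≢x = contradiction refl x≢x
  ... | yes _ with y + y ℚP.≟ 0ℚ
  ...   | yes y+y≡0 = contradiction y+y≡0 y+y≢0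
  ...   | no _      = refl

  add-self-vertical : ∀ a b c x y → y + y ≡ 0ℚ → add a b c (just (x , y)) (just (x , y)) ≡ nothing
  add-self-vertical a b c x y y+y≡0 with x ℚP.≟ x
  ... | no x≢x = contradiction refl x≢x
  ... | yes _ with y + y ℚP.≟ 0ℚ
  ...   | yes _      = refl
  ...   | no y+y≢0   = contradiction y+y≡0 y+y≢0

  tangentSlope-spec : ∀ a b x y → y + y ≢ 0ℚ →
    tangentSlope a b x y * (ι (+ 2) * y) ≡ ι (+ 3) * x * x + ι (+ 2) * ι a * x + ι b
  tangentSlope-spec a b x y y+y≢0 = inv-*-cancelʳ 2y≢0 _
    where
    y+y≡2y : y + y ≡ ι (+ 2) * y
    y+y≡2y = solve (y ∷ []) ℚ-ring
    2y≢0 : ι (+ 2) * y ≢ 0ℚ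
    2y≢0 2y≡0 = y+y≢0 (trans y+y≡2y 2y≡0)

  doubleX-roots : ∀ a b x y → x + x + doubleX a b x y ≡ tangentSlope a b x y * tangentSlope a b x y - ι a
  doubleX-roots a b x y = roots x (tangentSlope a b x y) (ι a)
    where
    roots : ∀ x L A → x + x + (L * L - A - x - x) ≡ L * L - A
    roots x L A = solve (x ∷ L ∷ A ∷ []) ℚ-ring

  double-onCurve : ∀ a b c x y → OnCurve a b c x y → y + y ≢ 0ℚ →
    OnCurve a b c (doubleX a b x y) (doubleY a b x y)
  double-onCurve a b c x y curve y+y≢0 =
    tangent-onCurve (ι a) (ι b) (ι c) x y (tangentSlope a b x y) (doubleX a b x y)
      curve (tangentSlope-spec a b x y y+y≢0) (doubleX-roots a b x y)

  homogenised-curveℤ : ∀ a b c x y (D D′ U V : ℤ) → OnCurve a b c x y → x * ι D ≡ ι U → y * ι D′ ≡ ι V →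
    V ℤ.* V ℤ.* (D ℤ.* D ℤ.* D) ≡
      D′ ℤ.* D′ ℤ.* (U ℤ.* U ℤ.* U ℤ.+ D ℤ.* (a ℤ.* U ℤ.* U ℤ.+ b ℤ.* U ℤ.* D ℤ.+ c ℤ.* (D ℤ.* D)))
  homogenised-curveℤ a b c x y D D′ U V curve xD≡U yD′≡V =
    ⟦⟧ℚ-injective (V̂ ⊗ V̂ ⊗ (D̂ ⊗ D̂ ⊗ D̂))
      (D̂′ ⊗ D̂′ ⊗ (Û ⊗ Û ⊗ Û ⊕ D̂ ⊗ (lit a ⊗ Û ⊗ Û ⊕ lit b ⊗ Û ⊗ D̂ ⊕ lit c ⊗ (D̂ ⊗ D̂))))
      (homogenised-curve (ι a) (ι b) (ι c) x y (ι D) (ι D′) (ι U) (ι V) curve xD≡U yD′≡V)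
    where
    D̂ = lit D
    D̂′ = lit D′
    Û = lit U
    V̂ = lit V

  -- x(2Q) = (x⁴ - 2bx² - 8cx + b² - 4ac)/(4y²); for x = m/e² the numerator
  -- becomes (m⁴ + e²·doubling-tail a b c m e)/e⁸.
  doubling-tail : ℤ → ℤ → ℤ → ℤ → ℤ → ℤ
  doubling-tail a b c m e =
    (b ℤ.* b ℤ.- + 4 ℤ.* a ℤ.* c) ℤ.* (e ℤ.* e ℤ.* e ℤ.* e ℤ.* e ℤ.* e)
    ℤ.- + 2 ℤ.* b ℤ.* m ℤ.* m ℤ.* (e ℤ.* e) ℤ.- + 8 ℤ.* c ℤ.* m ℤ.* (e ℤ.* e ℤ.* e ℤ.* e)

  doubling-numeratorℤ : ∀ a b c x y (e e′ m n m′ : ℤ) → OnCurve a b c x y → y + y ≢ 0ℚ →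
    x * (ι e * ι e) ≡ ι m → y * (ι e * ι e * ι e) ≡ ι n → doubleX a b x y * (ι e′ * ι e′) ≡ ι m′ →
    m′ ℤ.* ((+ 2 ℤ.* n ℤ.* e) ℤ.* (+ 2 ℤ.* n ℤ.* e)) ≡
      (m ℤ.* m ℤ.* m ℤ.* m ℤ.+ e ℤ.* e ℤ.* doubling-tail a b c m e) ℤ.* (e′ ℤ.* e′)
  doubling-numeratorℤ a b c x y e e′ m n m′ curve y+y≢0 hm hn hm′ =
    ⟦⟧ℚ-injective (lit m′ ⊗ ((lit (+ 2) ⊗ n̂ ⊗ ê) ⊗ (lit (+ 2) ⊗ n̂ ⊗ ê)))
      ((m̂ ⊗ m̂ ⊗ m̂ ⊗ m̂ ⊕ ê ⊗ ê ⊗ tail) ⊗ (lit e′ ⊗ lit e′))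
      (doubling-numerator (ι a) (ι b) (ι c) x y (tangentSlope a b x y) (doubleX a b x y) (ι e) (ι e′)
        curve (tangentSlope-spec a b x y y+y≢0) (doubleX-roots a b x y) hm hn hm′)
    where
    ê = lit e
    m̂ = lit m
    n̂ = lit n
    tail : IntExpr
    tail = (lit b ⊗ lit b ⊕ ⊝ (lit (+ 4) ⊗ lit a ⊗ lit c)) ⊗ (ê ⊗ ê ⊗ ê ⊗ ê ⊗ ê ⊗ ê)
           ⊕ ⊝ (lit (+ 2) ⊗ lit b ⊗ m̂ ⊗ m̂ ⊗ (ê ⊗ ê)) ⊕ ⊝ (lit (+ 8) ⊗ lit c ⊗ m̂ ⊗ (ê ⊗ ê ⊗ ê ⊗ ê))

module _ where

  open import Data.Nat using (_*_)

  private variable m n o : ℕ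

  coprime-∣ʳ : ∀ {d} → Coprime m n → d ∣ n → Coprime m d
  coprime-∣ʳ m⊥n d∣n (i∣m , i∣d) = m⊥n (i∣m , ∣-trans i∣d d∣n)

  coprime-*ˡ : Coprime m o → Coprime n o → Coprime (m * n) o
  coprime-*ˡ m⊥o n⊥o (i∣mn , i∣o) =
    n⊥o (coprime-divisor (Coprimality.sym (coprime-∣ʳ m⊥o i∣o)) i∣mn , i∣o)

  coprime-*ʳ : Coprime o m → Coprime o n → Coprime o (m * n)
  coprime-*ʳ o⊥m o⊥n = Coprimality.sym (coprime-*ˡ (Coprimality.sym o⊥m) (Coprimality.sym o⊥n))

  coprime-∣*∣ : ∀ i j {g} → Coprime ∣ i ∣ g → Coprime ∣ j ∣ g → Coprime ∣ i ℤ.* j ∣ g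
  coprime-∣*∣ i j {g} i⊥g j⊥g = subst (λ k → Coprime k g) (sym (ℤP.abs-* i j)) (coprime-*ˡ i⊥g j⊥g)

  coprime-∣+*∣ : ∀ u k w {g} → Coprime ∣ u ∣ g → g ∣ ∣ k ∣ → Coprime ∣ u ℤ.+ k ℤ.* w ∣ g
  coprime-∣+*∣ u k w {g} u⊥g g∣k {i} (i∣u+kw , i∣g) = u⊥g (ℤ∣.∣⇒∣ᵤ i∣u , i∣g)
    where
    i∣kw : + i ℤ∣.∣ k ℤ.* w
    i∣kw = ℤ∣.∣m⇒∣m*n w (ℤ∣.∣ᵤ⇒∣ {+ i} {k} (∣-trans i∣g g∣k))
    i∣u : + i ℤ∣.∣ u
    i∣u = ℤ∣.∣m+n∣n⇒∣m (ℤ∣.∣ᵤ⇒∣ i∣u+kw) i∣kw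

  m*m∣n*n⇒m∣n : m * m ∣ n * n → m ∣ n
  m*m∣n*n⇒m∣n {m} {n} m²∣n² with gcd m n ℕ.≟ 0
  ... | yes g≡0 = subst₂ _∣_ (sym (gcd[m,n]≡0⇒m≡0 g≡0)) (sym (gcd[m,n]≡0⇒n≡0 m g≡0)) ∣-refl
  ... | no g≢0 = subst (_∣ n) (sym m≡g) (gcd[m,n]∣n m n)
    where
    g = gcd m n
    instance _ = ℕ.≢-nonZero g≢0
    square : ∀ p q → p * q * (p * q) ≡ p * p * (q * q)
    square = ℕ-Solver.solve-∀
    m′²∣n′² : m / g * (m / g) ∣ n / g * (n / g)
    m′²∣n′² = *-cancelʳ-∣ (g * g) {{ℕP.m*n≢0 g g}} (subst₂ _∣_
      (trans (cong (λ k → k * k) (sym (m/n*n≡m (gcd[m,n]∣m m n)))) (square (m / g) g))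
      (trans (cong (λ k → k * k) (sym (m/n*n≡m (gcd[m,n]∣n m n)))) (square (n / g) g)) m²∣n²)
    m′⊥n′ : Coprime (m / g) (n / g)
    m′⊥n′ = Coprimality.coprime-/gcd m n
    m′∣n′ : m / g ∣ n / g
    m′∣n′ = coprime-divisor m′⊥n′ (∣-trans (m∣m*n (m / g)) m′²∣n′²)
    m≡g : m ≡ g
    m≡g = begin
      m         ≡⟨ m/n*n≡m (gcd[m,n]∣m m n) ⟨
      m / g * g ≡⟨ cong (_* g) (m′⊥n′ (∣-refl , m′∣n′)) ⟩
      1 * g     ≡⟨ ℕP.*-identityˡ g ⟩
      g         ∎
      where open ≡-Reasoning

  square≡cube⇒ : ∀ c d → c * c ≡ d * d * d → ∃[ e ] (d ≡ e * e × c ≡ e * d)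
  square≡cube⇒ zero    zero      _     = 0 , refl , refl
  square≡cube⇒ (suc _) zero      ()
  square≡cube⇒ c       d@(suc _) c²≡d³ = e , d≡e*e , c≡e*d
    where
    d∣c : d ∣ c
    d∣c = m*m∣n*n⇒m∣n (divides d (trans c²≡d³ (ℕP.*-assoc d d d)))
    e = quotient d∣c
    c≡e*d : c ≡ e * d
    c≡e*d = m∣n⇒n≡quotient*m d∣c
    regroup : ∀ e d → e * d * (e * d) ≡ e * e * (d * d)
    regroup = ℕ-Solver.solve-∀
    d≡e*e : d ≡ e * e
    d≡e*e = sym (ℕP.*-cancelʳ-≡ (e * e) d (d * d) (begin
      e * e * (d * d) ≡⟨ regroup e d ⟨
      e * d * (e * d) ≡⟨ cong (λ k → k * k) c≡e*d ⟨
      c * c           ≡⟨ c²≡d³ ⟩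
      d * d * d       ≡⟨ ℕP.*-assoc d d d ⟩
      d * (d * d)     ∎))
      where open ≡-Reasoning

  coprime-cross-equation : ∀ {v c w d} → Coprime v c → Coprime w d →
    v * v * (d * d * d) ≡ c * c * w → c * c ≡ d * d * d
  coprime-cross-equation {v} {c} {w} {d} v⊥c w⊥d eq = ∣-antisym c²∣d³ d³∣c²
    where
    c⊥v = Coprimality.sym v⊥c
    d⊥w = Coprimality.sym w⊥d
    c²∣d³ : c * c ∣ d * d * d
    c²∣d³ = coprime-divisor (coprime-*ʳ (coprime-*ˡ c⊥v c⊥v) (coprime-*ˡ c⊥v c⊥v))
              (divides w (trans eq (ℕP.*-comm (c * c) w)))
    d³∣c² : d * d * d ∣ c * c
    d³∣c² = coprime-divisor (coprime-*ˡ (coprime-*ˡ d⊥w d⊥w) d⊥w)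
              (divides (v * v) (trans (ℕP.*-comm w (c * c)) (sym eq)))

  ∣-from-square-equation : ∀ {x g k m e} → Coprime x g → g ∣ k → m * (k * k) ≡ x * (e * e) → g ∣ e
  ∣-from-square-equation {x} {g} {k} {m} {e} x⊥g g∣k eq = m*m∣n*n⇒m∣n g²∣e²
    where
    g²∣x*e² : g * g ∣ x * (e * e)
    g²∣x*e² = subst (g * g ∣_) eq (∣-trans (*-pres-∣ g∣k g∣k) (n∣m*n m))
    g²∣e² : g * g ∣ e * e
    g²∣e² = coprime-divisor (coprime-*ˡ (Coprimality.sym x⊥g) (Coprimality.sym x⊥g)) g²∣x*e²

  even-cofactor : ∀ {f e} → .{{NonZero e}} → (2 ∣ e → 2 * e ∣ f * e) → 2 ∣ f * e → 2 ∣ f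
  even-cofactor {f} {e} even-step 2∣fe with 2 ∣? e
  ... | yes 2∣e = *-cancelʳ-∣ e (even-step 2∣e)
  ... | no 2∤e with euclidsLemma f e prime[2] 2∣fe
  ...   | inj₁ 2∣f = 2∣f
  ...   | inj₂ 2∣e = contradiction 2∣e 2∤e

  even⇒≡2⊎composite : ∀ {f} → .{{NonZero f}} → 2 ∣ f → f ≡ 2 ⊎ Composite f
  even⇒≡2⊎composite {f} 2∣f with 2 ℕ.≟ f
  ... | yes 2≡f = inj₁ (sym 2≡f)
  ... | no 2≢f  = inj₂ (composite-≢ 2 2≢f 2∣f)

  quotient≡2⊎composite : ∀ {e e′} → .{{NonZero e}} → .{{NonZero e′}} →
    e ∣ e′ → (2 ∣ e → 2 * e ∣ e′) → 2 ∣ e′ → ∃[ f ] (e′ ≡ f * e × (f ≡ 2 ⊎ Composite f))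
  quotient≡2⊎composite {e} {e′} e∣e′ even-step 2∣e′ =
    f , e′≡f*e , even⇒≡2⊎composite {{ℕP.m*n≢0⇒m≢0 f {{subst NonZero e′≡f*e it}}}}
      (even-cofactor (λ 2∣e → subst (2 * e ∣_) e′≡f*e (even-step 2∣e)) (subst (2 ∣_) e′≡f*e 2∣e′))
    where
    f = quotient e∣e′
    e′≡f*e : e′ ≡ f * e
    e′≡f*e = m∣n⇒n≡quotient*m e∣e′

  record LowestTerms (x y : ℚ) (e : ℕ) (m n : ℤ) : Set where
    field
      positive    : 1 ≤ e
      x-numerator : x ℚ.* (ι (+ e) ℚ.* ι (+ e)) ≡ ι m
      y-numerator : y ℚ.* (ι (+ e) ℚ.* ι (+ e) ℚ.* ι (+ e)) ≡ ι n
      m⊥e         : Coprime ∣ m ∣ e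
      n⊥e         : Coprime ∣ n ∣ e

  denominators-of-point : ∀ a b c x y → OnCurve a b c x y → ℚ.↧ₙ y * ℚ.↧ₙ y ≡ ℚ.↧ₙ x * ℚ.↧ₙ x * ℚ.↧ₙ x
  denominators-of-point a b c x@(ℚ.mkℚ U d-1 x-reduced) y@(ℚ.mkℚ V d′-1 y-reduced) curve =
    coprime-cross-equation (Coprimality.recompute y-reduced) F⊥d homogenised
    where
    d = suc d-1
    d′ = suc d′-1
    D = + d
    D′ = + d′
    W = a ℤ.* U ℤ.* U ℤ.+ b ℤ.* U ℤ.* D ℤ.+ c ℤ.* (D ℤ.* D)
    F = U ℤ.* U ℤ.* U ℤ.+ D ℤ.* W
    U⊥d : Coprime ∣ U ∣ d
    U⊥d = Coprimality.recompute x-reduced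
    F⊥d : Coprime ∣ F ∣ d
    F⊥d = coprime-∣+*∣ (U ℤ.* U ℤ.* U) D W (coprime-∣*∣ (U ℤ.* U) U (coprime-∣*∣ U U U⊥d U⊥d) U⊥d) ∣-refl
    homogenised : ∣ V ∣ * ∣ V ∣ * (d * d * d) ≡ d′ * d′ * ∣ F ∣
    homogenised = begin
      ∣ V ∣ * ∣ V ∣ * (d * d * d)
        ≡⟨ cong₂ _*_ (ℤP.abs-* V V) (trans (ℤP.abs-* (D ℤ.* D) D) (cong (_* d) (ℤP.abs-* D D))) ⟨
      ∣ V ℤ.* V ∣ * ∣ D ℤ.* D ℤ.* D ∣ ≡⟨ ℤP.abs-* (V ℤ.* V) (D ℤ.* D ℤ.* D) ⟨
      ∣ V ℤ.* V ℤ.* (D ℤ.* D ℤ.* D) ∣ ≡⟨ cong ∣_∣ (homogenised-curveℤ a b c x y D D′ U V curve (*-↧≡↥ x) (*-↧≡↥ y)) ⟩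
      ∣ D′ ℤ.* D′ ℤ.* F ∣             ≡⟨ ℤP.abs-* (D′ ℤ.* D′) F ⟩
      ∣ D′ ℤ.* D′ ∣ * ∣ F ∣           ≡⟨ cong (_* ∣ F ∣) (ℤP.abs-* D′ D′) ⟩
      d′ * d′ * ∣ F ∣                 ∎
      where open ≡-Reasoning

  lowestTerms : ∀ a b c x y → OnCurve a b c x y → ∃[ e ] ∃[ m ] ∃[ n ] LowestTerms x y e m n
  lowestTerms a b c x@(ℚ.mkℚ U d-1 x-reduced) y@(ℚ.mkℚ V d′-1 y-reduced) curve = e , U , V , record
    { positive    = ℕ.>-nonZero⁻¹ e {{ℕP.m*n≢0⇒m≢0 e {{subst NonZero d≡e*e _}}}}
    ; x-numerator = subst (λ q → x ℚ.* q ≡ ι U) ι[d]≡ (*-↧≡↥ x)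
    ; y-numerator = subst (λ q → y ℚ.* q ≡ ι V) ι[d′]≡ (*-↧≡↥ y)
    ; m⊥e         = coprime-∣ʳ (Coprimality.recompute x-reduced) (subst (e ∣_) (sym d≡e*e) (m∣m*n e))
    ; n⊥e         = coprime-∣ʳ (Coprimality.recompute y-reduced) (subst (e ∣_) (sym d′≡e*d) (m∣m*n d))
    }
    where
    d = suc d-1
    d′ = suc d′-1
    root = square≡cube⇒ d′ d (denominators-of-point a b c x y curve)
    e = proj₁ root
    d≡e*e = proj₁ (proj₂ root)
    d′≡e*d = proj₂ (proj₂ root)
    ι[d]≡ : ι (+ d) ≡ ι (+ e) ℚ.* ι (+ e)
    ι[d]≡ = trans (cong (λ k → ι (+ k)) d≡e*e) (ι-pos-* e e)
    ι[d′]≡ : ι (+ d′) ≡ ι (+ e) ℚ.* ι (+ e) ℚ.* ι (+ e)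
    ι[d′]≡ = begin
      ι (+ d′)                          ≡⟨ cong (λ k → ι (+ k)) d′≡e*d ⟩
      ι (+ (e * d))                     ≡⟨ ι-pos-* e d ⟩
      ι (+ e) ℚ.* ι (+ d)               ≡⟨ cong (ι (+ e) ℚ.*_) ι[d]≡ ⟩
      ι (+ e) ℚ.* (ι (+ e) ℚ.* ι (+ e)) ≡⟨ ℚP.*-assoc (ι (+ e)) (ι (+ e)) (ι (+ e)) ⟨
      ι (+ e) ℚ.* ι (+ e) ℚ.* ι (+ e)   ∎
      where open ≡-Reasoning

  denominator-doubling : ∀ a b c {x y e e′ m n m′ n′} → OnCurve a b c x y → y ℚ.+ y ≢ 0ℚ →
    LowestTerms x y e m n → LowestTerms (doubleX a b x y) (doubleY a b x y) e′ m′ n′ →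
    e ∣ e′ × (2 ∣ e → 2 * e ∣ e′)
  denominator-doubling a b c {x} {y} {e} {e′} {m} {n} {m′} curve y+y≢0 Q Q′ =
      divides-e′ m⊥e (m∣m*n e) (n∣m*n (2 * ∣ n ∣) {e})
    , λ 2∣e → divides-e′ (coprime-*ʳ (coprime-∣ʳ m⊥e 2∣e) m⊥e) (*-monoˡ-∣ e 2∣e)
                (*-pres-∣ (m∣m*n {2} ∣ n ∣) (∣-refl {e}))
    where
    open LowestTerms Q using (x-numerator; y-numerator; m⊥e)
    E = + e
    E′ = + e′
    K = + 2 ℤ.* n ℤ.* E
    m⁴ = m ℤ.* m ℤ.* m ℤ.* m
    X = m⁴ ℤ.+ E ℤ.* E ℤ.* doubling-tail a b c m E
    numerator : ∣ m′ ∣ * (∣ K ∣ * ∣ K ∣) ≡ ∣ X ∣ * (e′ * e′)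
    numerator = begin
      ∣ m′ ∣ * (∣ K ∣ * ∣ K ∣) ≡⟨ cong (∣ m′ ∣ *_) (ℤP.abs-* K K) ⟨
      ∣ m′ ∣ * ∣ K ℤ.* K ∣     ≡⟨ ℤP.abs-* m′ (K ℤ.* K) ⟨
      ∣ m′ ℤ.* (K ℤ.* K) ∣     ≡⟨ cong ∣_∣ (doubling-numeratorℤ a b c x y E E′ m n m′ curve y+y≢0
                                   x-numerator y-numerator (LowestTerms.x-numerator Q′)) ⟩
      ∣ X ℤ.* (E′ ℤ.* E′) ∣    ≡⟨ ℤP.abs-* X (E′ ℤ.* E′) ⟩
      ∣ X ∣ * ∣ E′ ℤ.* E′ ∣    ≡⟨ cong (∣ X ∣ *_) (ℤP.abs-* E′ E′) ⟩
      ∣ X ∣ * (e′ * e′)        ∎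
      where open ≡-Reasoning
    ∣K∣ : ∣ K ∣ ≡ 2 * ∣ n ∣ * e
    ∣K∣ = trans (ℤP.abs-* (+ 2 ℤ.* n) E) (cong (_* e) (ℤP.abs-* (+ 2) n))
    divides-e′ : ∀ {g} → Coprime ∣ m ∣ g → g ∣ e * e → g ∣ 2 * ∣ n ∣ * e → g ∣ e′
    divides-e′ {g} m⊥g g∣e² g∣K = ∣-from-square-equation {m = ∣ m′ ∣} X⊥g (subst (g ∣_) (sym ∣K∣) g∣K) numerator
      where
      m⁴⊥g : Coprime ∣ m⁴ ∣ g
      m⁴⊥g = coprime-∣*∣ (m ℤ.* m ℤ.* m) m (coprime-∣*∣ (m ℤ.* m) m (coprime-∣*∣ m m m⊥g m⊥g) m⊥g) m⊥g
      X⊥g : Coprime ∣ X ∣ g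
      X⊥g = coprime-∣+*∣ m⁴ (E ℤ.* E) (doubling-tail a b c m E) m⁴⊥g (subst (g ∣_) (sym (ℤP.abs-* E E)) g∣e²)

  even-denominator⇒y+y≢0 : ∀ {x y e m n} → LowestTerms x y e m n → 2 ∣ e → y ℚ.+ y ≢ 0ℚ
  even-denominator⇒y+y≢0 {y = y} {e} {n = n} Q 2∣e y+y≡0 = contradiction (∣1⇒≡1 (subst (2 ∣_) e≡1 2∣e)) λ ()
    where
    open LowestTerms Q using (y-numerator; n⊥e)
    ε = ι (+ e)
    y≡0 : y ≡ 0ℚ
    y≡0 = begin
      y               ≡⟨ solve (y ∷ []) ℚ-ring ⟩
      (y ℚ.+ y) ℚ.* ½ ≡⟨ cong (ℚ._* ½) y+y≡0 ⟩
      0ℚ ℚ.* ½        ≡⟨ ℚP.*-zeroˡ ½ ⟩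
      0ℚ              ∎
      where open ≡-Reasoning
    n≡0 : n ≡ + 0
    n≡0 = ι-injective (trans (sym y-numerator) (trans (cong (ℚ._* (ε ℚ.* ε ℚ.* ε)) y≡0) (ℚP.*-zeroˡ (ε ℚ.* ε ℚ.* ε))))
    e≡1 : e ≡ 1
    e≡1 = Coprimality.0-coprimeTo-m⇒m≡1 (subst (λ k → Coprime ∣ k ∣ e) n≡0 n⊥e)

  module Orbit (a b c : ℤ) (P : Pt) where

    dbl^-suc : ∀ k {x y} → dbl^ a b c k P ≡ just (x , y) → y ℚ.+ y ≢ 0ℚ →
      dbl^ a b c (suc k) P ≡ just (doubleX a b x y , doubleY a b x y)
    dbl^-suc _ {x} {y} eq y+y≢0 = trans (cong (λ Q → add a b c Q Q) eq) (add-self a b c x y y+y≢0)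

    dbl^-suc-inversion : ∀ k {x′ y′} → dbl^ a b c (suc k) P ≡ just (x′ , y′) →
      ∃[ x ] ∃[ y ] (dbl^ a b c k P ≡ just (x , y) × y ℚ.+ y ≢ 0ℚ
                     × x′ ≡ doubleX a b x y × y′ ≡ doubleY a b x y)
    dbl^-suc-inversion k eq′ with dbl^ a b c k P in eq
    ... | nothing = case eq′ of λ ()
    ... | just (x , y) with y ℚ.+ y ℚP.≟ 0ℚ
    ...   | yes y+y≡0 = case trans (sym (add-self-vertical a b c x y y+y≡0)) eq′ of λ ()
    ...   | no y+y≢0 with trans (sym (add-self a b c x y y+y≢0)) eq′
    ...     | refl = x , y , refl , y+y≢0 , refl , refl

    IsE⇒LowestTerms : ∀ k {e} → IsE a b c P k e →
      ∃[ x ] ∃[ y ] ∃[ m ] ∃[ n ] (dbl^ a b c k P ≡ just (x , y) × LowestTerms x y e m n)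
    IsE⇒LowestTerms _ {e} (1≤e , x , y , m , n , eq , x≡ , y≡ , m⊥e , n⊥e) = x , y , m , n , eq , record
      { positive    = 1≤e
      ; x-numerator = subst (λ q → x ℚ.* q ≡ ι m) (ι-square e) (≡*inv⇒*≡ (ι-pos≢0 (e ℕ.^ 2) {{ℕP.m^n≢0 e 2}}) x≡)
      ; y-numerator = subst (λ q → y ℚ.* q ≡ ι n) (ι-cube e) (≡*inv⇒*≡ (ι-pos≢0 (e ℕ.^ 3) {{ℕP.m^n≢0 e 3}}) y≡)
      ; m⊥e         = m⊥e
      ; n⊥e         = n⊥e
      }
      where instance _ = ℕ.>-nonZero 1≤e

    LowestTerms⇒IsE : ∀ k {e x y m n} → dbl^ a b c k P ≡ just (x , y) → LowestTerms x y e m n → IsE a b c P k e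
    LowestTerms⇒IsE _ {e} {x} {y} {m} {n} eq Q = positive , x , y , m , n , eq
      , *≡⇒≡*inv (ι-pos≢0 (e ℕ.^ 2) {{ℕP.m^n≢0 e 2}}) (subst (λ q → x ℚ.* q ≡ ι m) (sym (ι-square e)) x-numerator)
      , *≡⇒≡*inv (ι-pos≢0 (e ℕ.^ 3) {{ℕP.m^n≢0 e 3}}) (subst (λ q → y ℚ.* q ≡ ι n) (sym (ι-cube e)) y-numerator)
      , m⊥e , n⊥e
      where
      open LowestTerms Q
      instance _ = ℕ.>-nonZero positive

  module OrbitOnCurve (a b c : ℤ) (x₀ y₀ : ℚ) (onCurve₀ : OnCurve a b c x₀ y₀) where

    open Orbit a b c (just (x₀ , y₀))

    dbl^-onCurve : ∀ k {x y} → dbl^ a b c k (just (x₀ , y₀)) ≡ just (x , y) → OnCurve a b c x y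
    dbl^-onCurve zero    refl = onCurve₀
    dbl^-onCurve (suc k) eq   with dbl^-suc-inversion k eq
    ... | x , y , eqₖ , y+y≢0 , x′≡ , y′≡ =
      subst₂ (OnCurve a b c) (sym x′≡) (sym y′≡) (double-onCurve a b c x y (dbl^-onCurve k eqₖ) y+y≢0)

    denominator-divides : ∀ k {e e′} → IsE a b c (just (x₀ , y₀)) k e → IsE a b c (just (x₀ , y₀)) (suc k) e′ →
      e ∣ e′ × (2 ∣ e → 2 * e ∣ e′)
    denominator-divides k isE isE′ with IsE⇒LowestTerms k isE | IsE⇒LowestTerms (suc k) isE′
    ... | x , y , _ , _ , eq , Q | _ , _ , _ , _ , eq′ , Q′ with dbl^-suc-inversion k eq′
    ...   | _ , _ , eq₁ , y+y≢0 , x′≡ , y′≡ with trans (sym eq) eq₁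
    ...     | refl = denominator-doubling a b c (dbl^-onCurve k eq) y+y≢0 Q
                       (subst₂ (λ u v → LowestTerms u v _ _ _) x′≡ y′≡ Q′)

    previous-denominator : ∀ k {e′} → IsE a b c (just (x₀ , y₀)) (suc k) e′ →
      ∃[ e ] IsE a b c (just (x₀ , y₀)) k e
    previous-denominator k isE′ =
      let (_ , _ , _ , _ , eq′ , _) = IsE⇒LowestTerms (suc k) isE′
          (x , y , eq , _) = dbl^-suc-inversion k eq′
          (e , _ , _ , Q) = lowestTerms a b c x y (dbl^-onCurve k eq)
      in e , LowestTerms⇒IsE k eq Q

    even-denominator-step : ∀ k {e} → IsE a b c (just (x₀ , y₀)) k e → 2 ∣ e →
      ∃[ e′ ] (IsE a b c (just (x₀ , y₀)) (suc k) e′ × 2 ∣ e′)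
    even-denominator-step k {e} isE 2∣e =
      let (x , y , _ , _ , eq , Q) = IsE⇒LowestTerms k isE
          y+y≢0 = even-denominator⇒y+y≢0 Q 2∣e
          onCurve = dbl^-onCurve k eq
          (e′ , _ , _ , Q′) = lowestTerms a b c _ _ (double-onCurve a b c x y onCurve y+y≢0)
          (_ , 2e∣e′) = denominator-doubling a b c onCurve y+y≢0 Q Q′
      in e′ , LowestTerms⇒IsE (suc k) (dbl^-suc k eq y+y≢0) Q′ , ∣-trans (m∣m*n e) (2e∣e′ 2∣e)

    even-denominators-from : ∀ {t k} → ∃[ e ] (IsE a b c (just (x₀ , y₀)) t e × 2 ∣ e) → t ≤′ k →
      ∃[ e ] (IsE a b c (just (x₀ , y₀)) k e × 2 ∣ e)
    even-denominators-from even-eₜ ≤′-refl = even-eₜ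
    even-denominators-from {k = suc k} even-eₜ (≤′-step t≤′k) =
      let (_ , isE , 2∣e) = even-denominators-from even-eₜ t≤′k in even-denominator-step k isE 2∣e

theorem6p1 : (a b c : ℤ) → IsElliptic a b c →
    (x₀ y₀ : ℚ) → OnCurve a b c x₀ y₀ →
    InfiniteOrder a b c (just (x₀ , y₀)) →
    (t : ℕ) → (∃[ eₜ ] (IsE a b c (just (x₀ , y₀)) t eₜ × 2 ∣ eₜ)) →
    (k : ℕ) → t ≤ k →
    ∃[ f ] (IsF a b c (just (x₀ , y₀)) k f × (f ≡ 2 ⊎ Composite f))
theorem6p1 a b c _ x₀ y₀ onCurve₀ _ t even-eₜ zero t≤0 with refl ← ℕP.n≤0⇒n≡0 t≤0 =
  let (e , isE , 2∣e) = even-eₜ in e , isE , even⇒≡2⊎composite {{ℕ.>-nonZero (proj₁ isE)}} 2∣e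
theorem6p1 a b c _ x₀ y₀ onCurve₀ _ t even-eₜ (suc k) t≤1+k =
  let (e′ , isE′ , 2∣e′) = even-denominators-from even-eₜ (ℕP.≤⇒≤′ t≤1+k)
      (e , isE) = previous-denominator k isE′
      (e∣e′ , even-step) = denominator-divides k isE isE′
      (f , e′≡f*e , f≡2⊎composite) =
        quotient≡2⊎composite {{ℕ.>-nonZero (proj₁ isE)}} {{ℕ.>-nonZero (proj₁ isE′)}} e∣e′ even-step 2∣e′
  in f , (e′ , e , isE′ , isE , e′≡f*e) , f≡2⊎composite
  where open OrbitOnCurve a b c x₀ y₀ onCurve₀
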